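{- Let $\Gamma=\langle\rho_0,\rho_1,\rho_2\rangle$ be an sggi with $\sigma_1=\rho_0\rho_1$ and $\sigma_2=\rho_1\rho_2$, and suppose that for integers $i,j,a,b$ the relations $\sigma_2^{ -1}\sigma_1=\sigma_1^i\rho_1\sigma_2^j$ and $\sigma_2^{ -2}\sigma_1=\sigma_1^a\sigma_2^b$ hold in $\Gamma$. Then $\sigma_2^{ -1}\sigma_1^2=\sigma_1^{i-a}\rho_1\sigma_2^{b-j-2}$. Furthermore, conjugation by $\sigma_2$ inverts $\sigma_1^{i-3-a}$, and $\sigma_1$ commutes with $\sigma_2^{b-2}$; in particular the subgroups $\langle\sigma_1^{i-3-a}\rangle$ and $\langle\sigma_2^{b-2}\rangle$ are normal in $\Gamma$.
   Context: An sggi (string group generated by involutions) of rank 3 is a group $\Gamma=\langle\rho_0,\rho_1,\rho_2\rangle$ with distinguished generators each of order 2 satisfying $(\rho_0\rho_2)^2=1$. -}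

module Defs where

open import Level using (Level)
open import Algebra.Bundles using (Group)
open import Data.Nat using (ℕ; zero; suc)
open import Data.Integer using (ℤ; +_; -[1+_])
open import Data.Fin using (Fin; zero; suc)
open import Data.Bool using (Bool; true; false)
open import Data.List using (List; []; _∷_)
open import Data.Product using (_×_; _,_; ∃)
open import Relation.Nullary using (¬_)

module GroupDefs {c ℓ : Level} (G : Group c ℓ) where
  open Group G

  _^ℕ_ : Carrier → ℕ → Carrier
  x ^ℕ zero = ε
  x ^ℕ suc n = x ∙ (x ^ℕ n)

  _^ℤ_ : Carrier → ℤ → Carrier
  x ^ℤ (+ n) = x ^ℕ n
  x ^ℤ -[1+ n ] = (x ^ℕ suc n) ⁻¹

  gen : Carrier → Carrier → Carrier → Fin 3 → Carrier
  gen a b d zero = a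
  gen a b d (suc zero) = b
  gen a b d (suc (suc zero)) = d

  evalWord : Carrier → Carrier → Carrier → List (Fin 3 × Bool) → Carrier
  evalWord a b d [] = ε
  evalWord a b d ((k , false) ∷ w) = gen a b d k ∙ evalWord a b d w
  evalWord a b d ((k , true) ∷ w) = (gen a b d k) ⁻¹ ∙ evalWord a b d w

  GeneratedBy : Carrier → Carrier → Carrier → Set (c Level.⊔ ℓ)
  GeneratedBy a b d = ∀ g → ∃ λ (w : List (Fin 3 × Bool)) → g ≈ evalWord a b d w

  Involution : Carrier → Set ℓ
  Involution x = (x ∙ x ≈ ε) × ¬ (x ≈ ε)

  IsSggi3 : Carrier → Carrier → Carrier → Set (c Level.⊔ ℓ)
  IsSggi3 ρ₀ ρ₁ ρ₂ =
    GeneratedBy ρ₀ ρ₁ ρ₂ × Involution ρ₀ × Involution ρ₁ × Involution ρ₂ ×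
    ((ρ₀ ∙ ρ₂) ∙ (ρ₀ ∙ ρ₂) ≈ ε)

  ConjInverts : Carrier → Carrier → Set ℓ
  ConjInverts g x = (g ∙ x) ∙ g ⁻¹ ≈ x ⁻¹

  Commute : Carrier → Carrier → Set ℓ
  Commute x y = x ∙ y ≈ y ∙ x

  CyclicNormal : Carrier → Set (c Level.⊔ ℓ)
  CyclicNormal x = ∀ (g : Carrier) (m : ℤ) → ∃ λ (k : ℤ) → (g ∙ (x ^ℤ m)) ∙ g ⁻¹ ≈ x ^ℤ k

-- Conjugation by ρ₁ inverts σ₁ and σ₂, and (σ₁σ₂)² = (ρ₀ρ₂)² = 1, so σ₂ flips σ₁ (y flips x when
-- y x y = x⁻¹). By the first relation σ₁^i ρ₁ = σ₂⁻¹ σ₁ σ₂^-j; being an involution, it makes σ₂^(-j-1)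
-- flip σ₁, and two flips combine into σ₂^(-j-2) σ₁ σ₂^(-j-2) = σ₁. Substituting both relations into
-- σ₁^(i-a) ρ₁ σ₂^(b-j-2) and using this identity gives σ₂⁻¹ σ₁². That relation exhibits σ₂ σ₁^(i-a-2)
-- as a conjugate of the involution σ₂^-(b-j-2) ρ₁, so σ₂ flips σ₁^(i-a-2) as well as σ₁, and hence
-- inverts σ₁^(i-a-3). Conjugating the second relation by ρ₁ reverses it to σ₁ σ₂⁻² = σ₂^b σ₁^a, and
-- comparing the two forms shows that σ₁ commutes with σ₂^(b-2). Finally ρ₀ = σ₁ρ₁, ρ₁ and ρ₂ = ρ₁σ₂
-- each conjugate σ₁^(i-3-a) and σ₂^(b-2) to themselves or their inverses; this property is closed
-- under products and inverses, so every element of Γ normalizes both cyclic subgroups.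

module Submission where

open import Defs
open import Level using (Level)
open import Algebra.Bundles using (Group)
open import Data.Integer using (ℤ; +_; _-_)
open import Data.Product using (_×_)

open import Data.Bool using (true; false)
open import Data.Fin using (zero; suc)
open import Data.Integer as ℤ using (-[1+_]; _+_; -_)
import Data.Integer.Properties as ℤ
open import Data.Integer.Tactic.RingSolver using (solve-∀)
open import Data.List using (_∷_; [])
open import Data.Nat using (zero; suc)
open import Data.Product using (_,_; ∃)
open import Data.Sum using (_⊎_; inj₁; inj₂)
open import Relation.Binary.PropositionalEquality as ≡ using (_≡_)

module PowerProperties {c ℓ : Level} (G : Group c ℓ) where
  open Group G hiding (_-_)
  open GroupDefs G
  open import Algebra.Properties.Group G
  open import Relation.Binary.Reasoning.Setoid setoid

  ^ℤ-congʳ : ∀ x {m n} → m ≡ n → x ^ℤ m ≈ x ^ℤ n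
  ^ℤ-congʳ x ≡.refl = refl

  ^ℕ-congˡ : ∀ {x y} n → x ≈ y → x ^ℕ n ≈ y ^ℕ n
  ^ℕ-congˡ zero    x≈y = refl
  ^ℕ-congˡ (suc n) x≈y = ∙-cong x≈y (^ℕ-congˡ n x≈y)

  ^ℤ-congˡ : ∀ {x y} k → x ≈ y → x ^ℤ k ≈ y ^ℤ k
  ^ℤ-congˡ (+ n)    x≈y = ^ℕ-congˡ n x≈y
  ^ℤ-congˡ -[1+ n ] x≈y = ⁻¹-cong (^ℕ-congˡ (suc n) x≈y)

  x∙x^ℕn≈x^ℕn∙x : ∀ x n → x ∙ x ^ℕ n ≈ x ^ℕ n ∙ x
  x∙x^ℕn≈x^ℕn∙x x zero    = trans (identityʳ x) (sym (identityˡ x))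
  x∙x^ℕn≈x^ℕn∙x x (suc n) = begin
    x ∙ (x ∙ x ^ℕ n) ≈⟨ ∙-congˡ (x∙x^ℕn≈x^ℕn∙x x n) ⟩
    x ∙ (x ^ℕ n ∙ x) ≈⟨ assoc x (x ^ℕ n) x ⟨
    x ∙ x ^ℕ n ∙ x   ∎

  ^ℤ-suc : ∀ x k → x ^ℤ ℤ.suc k ≈ x ∙ x ^ℤ k
  ^ℤ-suc x (+ n)        = refl
  ^ℤ-suc x -[1+ zero ]  = sym (trans (∙-congˡ (⁻¹-cong (identityʳ x))) (inverseʳ x))
  ^ℤ-suc x -[1+ suc n ] = sym (begin
    x ∙ (x ∙ (x ∙ x ^ℕ n)) ⁻¹     ≈⟨ ∙-congˡ (⁻¹-cong (∙-congˡ (x∙x^ℕn≈x^ℕn∙x x n))) ⟩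
    x ∙ (x ∙ (x ^ℕ n ∙ x)) ⁻¹     ≈⟨ ∙-congˡ (⁻¹-cong (assoc x (x ^ℕ n) x)) ⟨
    x ∙ ((x ∙ x ^ℕ n) ∙ x) ⁻¹     ≈⟨ ∙-congˡ (⁻¹-anti-homo-∙ (x ∙ x ^ℕ n) x) ⟩
    x ∙ (x ⁻¹ ∙ (x ∙ x ^ℕ n) ⁻¹)  ≈⟨ assoc x (x ⁻¹) _ ⟨
    x ∙ x ⁻¹ ∙ (x ∙ x ^ℕ n) ⁻¹    ≈⟨ ∙-congʳ (inverseʳ x) ⟩
    ε ∙ (x ∙ x ^ℕ n) ⁻¹           ≈⟨ identityˡ _ ⟩
    (x ∙ x ^ℕ n) ⁻¹               ∎)

  ^ℤ-pred : ∀ x k → x ^ℤ ℤ.pred k ≈ x ⁻¹ ∙ x ^ℤ k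
  ^ℤ-pred x k = begin
    x ^ℤ ℤ.pred k                 ≈⟨ identityˡ _ ⟨
    ε ∙ x ^ℤ ℤ.pred k             ≈⟨ ∙-congʳ (inverseˡ x) ⟨
    x ⁻¹ ∙ x ∙ x ^ℤ ℤ.pred k      ≈⟨ assoc (x ⁻¹) x _ ⟩
    x ⁻¹ ∙ (x ∙ x ^ℤ ℤ.pred k)    ≈⟨ ∙-congˡ (^ℤ-suc x (ℤ.pred k)) ⟨
    x ⁻¹ ∙ x ^ℤ ℤ.suc (ℤ.pred k)  ≈⟨ ∙-congˡ (^ℤ-congʳ x (ℤ.suc-pred k)) ⟩
    x ⁻¹ ∙ x ^ℤ k                 ∎

  ^ℤ-homo-+ : ∀ x m n → x ^ℤ (m + n) ≈ x ^ℤ m ∙ x ^ℤ n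
  ^ℤ-homo-+ x (+ zero) n = trans (^ℤ-congʳ x (ℤ.+-identityˡ n)) (sym (identityˡ _))
  ^ℤ-homo-+ x (+ suc m) n = begin
    x ^ℤ (+ suc m + n)     ≈⟨ ^ℤ-congʳ x (ℤ.suc-+ m n) ⟩
    x ^ℤ ℤ.suc (+ m + n)   ≈⟨ ^ℤ-suc x (+ m + n) ⟩
    x ∙ x ^ℤ (+ m + n)     ≈⟨ ∙-congˡ (^ℤ-homo-+ x (+ m) n) ⟩
    x ∙ (x ^ℕ m ∙ x ^ℤ n)  ≈⟨ assoc x _ _ ⟨
    x ∙ x ^ℕ m ∙ x ^ℤ n    ∎
  ^ℤ-homo-+ x -[1+ zero ] n = begin
    x ^ℤ (-[1+ zero ] + n)     ≈⟨ ^ℤ-congʳ x (ℤ.pred-+ (+ 0) n) ⟩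
    x ^ℤ ℤ.pred (+ 0 + n)      ≈⟨ ^ℤ-pred x (+ 0 + n) ⟩
    x ⁻¹ ∙ x ^ℤ (+ 0 + n)      ≈⟨ ∙-cong (⁻¹-cong (sym (identityʳ x))) (^ℤ-congʳ x (ℤ.+-identityˡ n)) ⟩
    (x ∙ ε) ⁻¹ ∙ x ^ℤ n        ∎
  ^ℤ-homo-+ x -[1+ suc m ] n = begin
    x ^ℤ (-[1+ suc m ] + n)          ≈⟨ ^ℤ-congʳ x (ℤ.pred-+ -[1+ m ] n) ⟩
    x ^ℤ ℤ.pred (-[1+ m ] + n)       ≈⟨ ^ℤ-pred x (-[1+ m ] + n) ⟩
    x ⁻¹ ∙ x ^ℤ (-[1+ m ] + n)       ≈⟨ ∙-congˡ (^ℤ-homo-+ x -[1+ m ] n) ⟩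
    x ⁻¹ ∙ (x ^ℤ -[1+ m ] ∙ x ^ℤ n)  ≈⟨ assoc (x ⁻¹) _ _ ⟨
    x ⁻¹ ∙ x ^ℤ -[1+ m ] ∙ x ^ℤ n    ≈⟨ ∙-congʳ (^ℤ-pred x -[1+ m ]) ⟨
    x ^ℤ -[1+ suc m ] ∙ x ^ℤ n       ∎

  ^ℤ-homo-neg : ∀ x k → x ^ℤ (- k) ≈ (x ^ℤ k) ⁻¹
  ^ℤ-homo-neg x k = inverseʳ-unique (x ^ℤ k) (x ^ℤ (- k)) (begin
    x ^ℤ k ∙ x ^ℤ (- k)  ≈⟨ ^ℤ-homo-+ x k (- k) ⟨
    x ^ℤ (k + - k)       ≈⟨ ^ℤ-congʳ x (ℤ.+-inverseʳ k) ⟩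
    ε                    ∎)

  ^ℤ-homo-- : ∀ x m n → x ^ℤ (m - n) ≈ x ^ℤ m ∙ (x ^ℤ n) ⁻¹
  ^ℤ-homo-- x m n = trans (^ℤ-homo-+ x m (- n)) (∙-congˡ (^ℤ-homo-neg x n))

  ^ℤ-commute : ∀ x m n → x ^ℤ m ∙ x ^ℤ n ≈ x ^ℤ n ∙ x ^ℤ m
  ^ℤ-commute x m n = begin
    x ^ℤ m ∙ x ^ℤ n  ≈⟨ ^ℤ-homo-+ x m n ⟨
    x ^ℤ (m + n)     ≈⟨ ^ℤ-congʳ x (ℤ.+-comm m n) ⟩
    x ^ℤ (n + m)     ≈⟨ ^ℤ-homo-+ x n m ⟩
    x ^ℤ n ∙ x ^ℤ m  ∎

  x∙x^ℤk≈x^ℤk∙x : ∀ x k → x ∙ x ^ℤ k ≈ x ^ℤ k ∙ x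
  x∙x^ℤk≈x^ℤk∙x x k = begin
    x ∙ x ^ℤ k          ≈⟨ ∙-congʳ (identityʳ x) ⟨
    x ^ℤ (+ 1) ∙ x ^ℤ k   ≈⟨ ^ℤ-commute x (+ 1) k ⟩
    x ^ℤ k ∙ x ^ℤ (+ 1)   ≈⟨ ∙-congˡ (identityʳ x) ⟩
    x ^ℤ k ∙ x          ∎

  ⁻¹-^ℕ : ∀ x n → (x ⁻¹) ^ℕ n ≈ (x ^ℕ n) ⁻¹
  ⁻¹-^ℕ x zero    = sym ε⁻¹≈ε
  ⁻¹-^ℕ x (suc n) = begin
    x ⁻¹ ∙ (x ⁻¹) ^ℕ n  ≈⟨ ∙-congˡ (⁻¹-^ℕ x n) ⟩
    x ⁻¹ ∙ (x ^ℕ n) ⁻¹  ≈⟨ ⁻¹-anti-homo-∙ (x ^ℕ n) x ⟨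
    (x ^ℕ n ∙ x) ⁻¹     ≈⟨ ⁻¹-cong (x∙x^ℕn≈x^ℕn∙x x n) ⟨
    (x ∙ x ^ℕ n) ⁻¹     ∎

  ⁻¹-^ℤ : ∀ x k → (x ⁻¹) ^ℤ k ≈ (x ^ℤ k) ⁻¹
  ⁻¹-^ℤ x (+ n)    = ⁻¹-^ℕ x n
  ⁻¹-^ℤ x -[1+ n ] = ⁻¹-cong (⁻¹-^ℕ x (suc n))

module Conjugation {c ℓ : Level} (G : Group c ℓ) where
  open Group G hiding (_-_)
  open GroupDefs G
  open PowerProperties G
  open import Algebra.Properties.Group G
  open import Algebra.Properties.Monoid monoid using (elimˡ; cancelˡ; cancelʳ; cancelᶜ; uv∙wx≈u[vw∙x])
  open import Algebra.Solver.Monoid monoid using (solve; _⊜_; _⊕_)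
  open import Relation.Binary.Reasoning.Setoid setoid

  conj : Carrier → Carrier → Carrier
  conj g x = g ∙ x ∙ g ⁻¹

  conj-cong : ∀ {g h x y} → g ≈ h → x ≈ y → conj g x ≈ conj h y
  conj-cong g≈h x≈y = ∙-cong (∙-cong g≈h x≈y) (⁻¹-cong g≈h)

  conj-homo-∙ : ∀ g x y → conj g (x ∙ y) ≈ conj g x ∙ conj g y
  conj-homo-∙ g x y = begin
    g ∙ (x ∙ y) ∙ g ⁻¹                ≈⟨ ∙-congʳ (assoc g x y) ⟨
    g ∙ x ∙ y ∙ g ⁻¹                  ≈⟨ ∙-congʳ (∙-congʳ (cancelʳ (inverseˡ g) (g ∙ x))) ⟨
    g ∙ x ∙ g ⁻¹ ∙ g ∙ y ∙ g ⁻¹       ≈⟨ ∙-congʳ (assoc (g ∙ x ∙ g ⁻¹) g y) ⟩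
    g ∙ x ∙ g ⁻¹ ∙ (g ∙ y) ∙ g ⁻¹     ≈⟨ assoc (g ∙ x ∙ g ⁻¹) (g ∙ y) (g ⁻¹) ⟩
    g ∙ x ∙ g ⁻¹ ∙ (g ∙ y ∙ g ⁻¹)     ∎

  conj-ε : ∀ g → conj g ε ≈ ε
  conj-ε g = trans (∙-congʳ (identityʳ g)) (inverseʳ g)

  conj-homo-⁻¹ : ∀ g x → conj g (x ⁻¹) ≈ (conj g x) ⁻¹
  conj-homo-⁻¹ g x = inverseʳ-unique (conj g x) (conj g (x ⁻¹)) (begin
    conj g x ∙ conj g (x ⁻¹)  ≈⟨ conj-homo-∙ g x (x ⁻¹) ⟨
    conj g (x ∙ x ⁻¹)         ≈⟨ conj-cong refl (inverseʳ x) ⟩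
    conj g ε                  ≈⟨ conj-ε g ⟩
    ε                         ∎)

  conj-homo-^ℕ : ∀ g x n → conj g (x ^ℕ n) ≈ conj g x ^ℕ n
  conj-homo-^ℕ g x zero    = conj-ε g
  conj-homo-^ℕ g x (suc n) = trans (conj-homo-∙ g x (x ^ℕ n)) (∙-congˡ (conj-homo-^ℕ g x n))

  conj-homo-^ℤ : ∀ g x k → conj g (x ^ℤ k) ≈ conj g x ^ℤ k
  conj-homo-^ℤ g x (+ n)    = conj-homo-^ℕ g x n
  conj-homo-^ℤ g x -[1+ n ] = trans (conj-homo-⁻¹ g (x ^ℕ suc n)) (⁻¹-cong (conj-homo-^ℕ g x (suc n)))

  conj-∙ : ∀ g h x → conj (g ∙ h) x ≈ conj g (conj h x)
  conj-∙ g h x = begin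
    g ∙ h ∙ x ∙ (g ∙ h) ⁻¹        ≈⟨ ∙-congˡ (⁻¹-anti-homo-∙ g h) ⟩
    g ∙ h ∙ x ∙ (h ⁻¹ ∙ g ⁻¹)     ≈⟨ solve 5 (λ g h x h′ g′ → ((g ⊕ h) ⊕ x) ⊕ (h′ ⊕ g′) ⊜ (g ⊕ ((h ⊕ x) ⊕ h′)) ⊕ g′)
                                            refl g h x (h ⁻¹) (g ⁻¹) ⟩
    g ∙ (h ∙ x ∙ h ⁻¹) ∙ g ⁻¹     ∎

  conj-∙-≈ : ∀ {g h x y} → conj h x ≈ y → conj (g ∙ h) x ≈ conj g y
  conj-∙-≈ {g} {h} {x} hx≈y = trans (conj-∙ g h x) (conj-cong refl hx≈y)

  conj-ε-left : ∀ x → conj ε x ≈ x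
  conj-ε-left x = trans (∙-cong (identityˡ x) ε⁻¹≈ε) (identityʳ x)

  conj-⁻¹-conj : ∀ g x → conj (g ⁻¹) (conj g x) ≈ x
  conj-⁻¹-conj g x = begin
    conj (g ⁻¹) (conj g x)  ≈⟨ conj-∙ (g ⁻¹) g x ⟨
    conj (g ⁻¹ ∙ g) x       ≈⟨ conj-cong (inverseˡ g) refl ⟩
    conj ε x                ≈⟨ conj-ε-left x ⟩
    x                       ∎

  Commute⇒conj≈ : ∀ {g x} → Commute g x → conj g x ≈ x
  Commute⇒conj≈ {g} {x} gx≈xg = trans (∙-congʳ gx≈xg) (cancelʳ (inverseʳ g) x)

  ConjInverts-cong : ∀ {g x y} → x ≈ y → ConjInverts g x → ConjInverts g y
  ConjInverts-cong x≈y inv = trans (conj-cong refl (sym x≈y)) (trans inv (⁻¹-cong x≈y))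

  ConjInverts-^ℤ : ∀ {g x} k → ConjInverts g x → ConjInverts g (x ^ℤ k)
  ConjInverts-^ℤ {g} {x} k inv = begin
    conj g (x ^ℤ k)  ≈⟨ conj-homo-^ℤ g x k ⟩
    conj g x ^ℤ k    ≈⟨ ^ℤ-congˡ k inv ⟩
    (x ⁻¹) ^ℤ k      ≈⟨ ⁻¹-^ℤ x k ⟩
    (x ^ℤ k) ⁻¹      ∎

  ConjInverts-⁻¹ : ∀ {g x} → ConjInverts g x → ConjInverts g (x ⁻¹)
  ConjInverts-⁻¹ {g} {x} inv = trans (conj-homo-⁻¹ g x) (⁻¹-cong inv)

  ConjInverts⇒⁻¹∙≈∙ : ∀ {g x} → ConjInverts g x → x ⁻¹ ∙ g ≈ g ∙ x
  ConjInverts⇒⁻¹∙≈∙ {g} {x} inv = trans (∙-congʳ (sym inv)) (cancelʳ (inverseˡ g) (g ∙ x))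

  ConjInverts-reverse : ∀ {g x y z w} →
    ConjInverts g x → ConjInverts g y → ConjInverts g z → ConjInverts g w →
    x ∙ y ≈ z ∙ w → y ∙ x ≈ w ∙ z
  ConjInverts-reverse {g} {x} {y} {z} {w} gx gy gz gw xy≈zw = ⁻¹-injective (begin
    (y ∙ x) ⁻¹            ≈⟨ ⁻¹-anti-homo-∙ y x ⟩
    x ⁻¹ ∙ y ⁻¹           ≈⟨ ∙-cong gx gy ⟨
    conj g x ∙ conj g y   ≈⟨ conj-homo-∙ g x y ⟨
    conj g (x ∙ y)        ≈⟨ conj-cong refl xy≈zw ⟩
    conj g (z ∙ w)        ≈⟨ conj-homo-∙ g z w ⟩
    conj g z ∙ conj g w   ≈⟨ ∙-cong gz gw ⟩
    z ⁻¹ ∙ w ⁻¹           ≈⟨ ⁻¹-anti-homo-∙ w z ⟨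
    (w ∙ z) ⁻¹            ∎)

  Commute-⁻¹ˡ : ∀ {x z} → Commute x z → Commute (x ⁻¹) z
  Commute-⁻¹ˡ {x} {z} xz≈zx = begin
    x ⁻¹ ∙ z                ≈⟨ cancelʳ (inverseʳ x) (x ⁻¹ ∙ z) ⟨
    x ⁻¹ ∙ z ∙ x ∙ x ⁻¹     ≈⟨ ∙-congʳ (assoc (x ⁻¹) z x) ⟩
    x ⁻¹ ∙ (z ∙ x) ∙ x ⁻¹   ≈⟨ ∙-congʳ (∙-congˡ xz≈zx) ⟨
    x ⁻¹ ∙ (x ∙ z) ∙ x ⁻¹   ≈⟨ ∙-congʳ (cancelˡ (inverseˡ x) z) ⟩
    z ∙ x ⁻¹                ∎

  Commute-⁻¹ : ∀ {x y} → Commute x y → Commute (x ⁻¹) (y ⁻¹)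
  Commute-⁻¹ {x} {y} xy≈yx = begin
    x ⁻¹ ∙ y ⁻¹  ≈⟨ ⁻¹-anti-homo-∙ y x ⟨
    (y ∙ x) ⁻¹   ≈⟨ ⁻¹-cong xy≈yx ⟨
    (x ∙ y) ⁻¹   ≈⟨ ⁻¹-anti-homo-∙ x y ⟩
    y ⁻¹ ∙ x ⁻¹  ∎

  Commute-congʳ : ∀ {x y z} → y ≈ z → Commute x y → Commute x z
  Commute-congʳ y≈z xy≈yx = trans (∙-congˡ (sym y≈z)) (trans xy≈yx (∙-congʳ y≈z))

  ≈∙⇒∙⁻¹≈ : ∀ {x y z} → x ≈ y ∙ z → x ∙ z ⁻¹ ≈ y
  ≈∙⇒∙⁻¹≈ {y = y} {z} x≈yz = trans (∙-congʳ x≈yz) (cancelʳ (inverseʳ z) y)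

  relation-and-reverse⇒Commute : ∀ {s c a b} →
    c ∙ s ≈ a ∙ b → s ∙ c ≈ b ∙ a → Commute b c → Commute s (c ∙ b)
  relation-and-reverse⇒Commute {s} {c} {a} {b} cs≈ab sc≈ba bc≈cb = begin
    s ∙ (c ∙ b)  ≈⟨ assoc s c b ⟨
    s ∙ c ∙ b    ≈⟨ ∙-congʳ sc≈ba ⟩
    b ∙ a ∙ b    ≈⟨ assoc b a b ⟩
    b ∙ (a ∙ b)  ≈⟨ ∙-congˡ cs≈ab ⟨
    b ∙ (c ∙ s)  ≈⟨ assoc b c s ⟨
    b ∙ c ∙ s    ≈⟨ ∙-congʳ bc≈cb ⟩
    c ∙ b ∙ s    ∎

  involution⇒⁻¹≈ : ∀ {a} → a ∙ a ≈ ε → a ⁻¹ ≈ a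
  involution⇒⁻¹≈ {a} aa≈ε = sym (inverseˡ-unique a a aa≈ε)

  ConjInverts⇒∙-involution : ∀ {a w} → a ∙ a ≈ ε → ConjInverts a w → w ∙ a ∙ (w ∙ a) ≈ ε
  ConjInverts⇒∙-involution {a} {w} aa≈ε inv = begin
    w ∙ a ∙ (w ∙ a)   ≈⟨ assoc w a (w ∙ a) ⟩
    w ∙ (a ∙ (w ∙ a)) ≈⟨ ∙-congˡ (assoc a w a) ⟨
    w ∙ (a ∙ w ∙ a)   ≈⟨ ∙-congˡ (∙-congˡ (involution⇒⁻¹≈ aa≈ε)) ⟨
    w ∙ conj a w      ≈⟨ ∙-congˡ inv ⟩
    w ∙ w ⁻¹          ≈⟨ inverseʳ w ⟩
    ε                 ∎

  involutions⇒ConjInverts-∙ʳ : ∀ {a b} → a ∙ a ≈ ε → b ∙ b ≈ ε → ConjInverts b (a ∙ b)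
  involutions⇒ConjInverts-∙ʳ {a} {b} aa≈ε bb≈ε = begin
    b ∙ (a ∙ b) ∙ b ⁻¹  ≈⟨ ∙-congʳ (assoc b a b) ⟨
    b ∙ a ∙ b ∙ b ⁻¹    ≈⟨ cancelʳ (inverseʳ b) (b ∙ a) ⟩
    b ∙ a               ≈⟨ ∙-cong (involution⇒⁻¹≈ bb≈ε) (involution⇒⁻¹≈ aa≈ε) ⟨
    b ⁻¹ ∙ a ⁻¹         ≈⟨ ⁻¹-anti-homo-∙ a b ⟨
    (a ∙ b) ⁻¹          ∎

  involutions⇒ConjInverts-∙ˡ : ∀ {a b} → a ∙ a ≈ ε → b ∙ b ≈ ε → ConjInverts a (a ∙ b)
  involutions⇒ConjInverts-∙ˡ {a} {b} aa≈ε bb≈ε = begin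
    a ∙ (a ∙ b) ∙ a ⁻¹  ≈⟨ ∙-congʳ (assoc a a b) ⟨
    a ∙ a ∙ b ∙ a ⁻¹    ≈⟨ ∙-congʳ (elimˡ aa≈ε b) ⟩
    b ∙ a ⁻¹            ≈⟨ ∙-congʳ (involution⇒⁻¹≈ bb≈ε) ⟨
    b ⁻¹ ∙ a ⁻¹         ≈⟨ ⁻¹-anti-homo-∙ a b ⟨
    (a ∙ b) ⁻¹          ∎

  conj-involution : ∀ g {x} → x ∙ x ≈ ε → conj g x ∙ conj g x ≈ ε
  conj-involution g {x} xx≈ε =
    trans (sym (conj-homo-∙ g x x)) (trans (conj-cong refl xx≈ε) (conj-ε g))

  Flips : Carrier → Carrier → Set ℓ
  Flips y x = y ∙ x ∙ y ≈ x ⁻¹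

  involution⇒Flipsʳ : ∀ {x y} → x ∙ y ∙ (x ∙ y) ≈ ε → Flips y x
  involution⇒Flipsʳ {x} {y} sq =
    inverseʳ-unique x (y ∙ x ∙ y) (trans (sym (uv∙wx≈u[vw∙x] x y x y)) sq)

  involution⇒Flipsˡ : ∀ {x y} → y ∙ x ∙ (y ∙ x) ≈ ε → Flips y x
  involution⇒Flipsˡ {x} {y} sq =
    inverseˡ-unique (y ∙ x ∙ y) x (trans (assoc (y ∙ x) y x) sq)

  Flips-cancel : ∀ {x y w} → Flips y x → Flips w x → w ⁻¹ ∙ y ∙ x ∙ (y ∙ w ⁻¹) ≈ x
  Flips-cancel {x} {y} {w} yxy≈x⁻¹ wxw≈x⁻¹ = begin
    w ⁻¹ ∙ y ∙ x ∙ (y ∙ w ⁻¹)    ≈⟨ solve 4 (λ w′ y x y′ → ((w′ ⊕ y) ⊕ x) ⊕ (y′ ⊕ w′) ⊜ (w′ ⊕ ((y ⊕ x) ⊕ y′)) ⊕ w′)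
                                           refl (w ⁻¹) y x y ⟩
    w ⁻¹ ∙ (y ∙ x ∙ y) ∙ w ⁻¹    ≈⟨ ∙-congʳ (∙-congˡ yxy≈x⁻¹) ⟩
    w ⁻¹ ∙ x ⁻¹ ∙ w ⁻¹           ≈⟨ ∙-congʳ (⁻¹-anti-homo-∙ x w) ⟨
    (x ∙ w) ⁻¹ ∙ w ⁻¹            ≈⟨ ⁻¹-anti-homo-∙ w (x ∙ w) ⟨
    (w ∙ (x ∙ w)) ⁻¹             ≈⟨ ⁻¹-cong (assoc w x w) ⟨
    (w ∙ x ∙ w) ⁻¹               ≈⟨ ⁻¹-cong wxw≈x⁻¹ ⟩
    x ⁻¹ ⁻¹                      ≈⟨ ⁻¹-involutive x ⟩
    x                            ∎

  Flips⇒ConjInverts-∙⁻¹ : ∀ {x y z} → Flips y x → Flips y z → Commute x z → ConjInverts y (x ∙ z ⁻¹)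
  Flips⇒ConjInverts-∙⁻¹ {x} {y} {z} yxy≈x⁻¹ yzy≈z⁻¹ xz≈zx = begin
    y ∙ (x ∙ z ⁻¹) ∙ y ⁻¹                 ≈⟨ solve 4 (λ y x z′ y′ → (y ⊕ (x ⊕ z′)) ⊕ y′ ⊜ (y ⊕ x) ⊕ (z′ ⊕ y′))
                                                    refl y x (z ⁻¹) (y ⁻¹) ⟩
    y ∙ x ∙ (z ⁻¹ ∙ y ⁻¹)                 ≈⟨ cancelᶜ (inverseʳ y) (y ∙ x) (z ⁻¹ ∙ y ⁻¹) ⟨
    y ∙ x ∙ y ∙ (y ⁻¹ ∙ (z ⁻¹ ∙ y ⁻¹))    ≈⟨ ∙-cong yxy≈x⁻¹ (∙-congˡ (sym (⁻¹-anti-homo-∙ y z))) ⟩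
    x ⁻¹ ∙ (y ⁻¹ ∙ (y ∙ z) ⁻¹)            ≈⟨ ∙-congˡ (⁻¹-anti-homo-∙ (y ∙ z) y) ⟨
    x ⁻¹ ∙ (y ∙ z ∙ y) ⁻¹                 ≈⟨ ∙-congˡ (⁻¹-cong yzy≈z⁻¹) ⟩
    x ⁻¹ ∙ z ⁻¹ ⁻¹                        ≈⟨ ∙-congˡ (⁻¹-involutive z) ⟩
    x ⁻¹ ∙ z                              ≈⟨ Commute-⁻¹ˡ xz≈zx ⟩
    z ∙ x ⁻¹                              ≈⟨ ∙-congʳ (⁻¹-involutive z) ⟨
    z ⁻¹ ⁻¹ ∙ x ⁻¹                        ≈⟨ ⁻¹-anti-homo-∙ x (z ⁻¹) ⟨
    (x ∙ z ⁻¹) ⁻¹                         ∎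

module CyclicNormality {c ℓ : Level} (G : Group c ℓ) where
  open Group G hiding (_-_)
  open GroupDefs G
  open PowerProperties G
  open Conjugation G
  open import Algebra.Properties.Group G
  open import Relation.Binary.Reasoning.Setoid setoid

  FixesOrInverts : Carrier → Carrier → Set ℓ
  FixesOrInverts g x = conj g x ≈ x ⊎ ConjInverts g x

  FixesOrInverts-cong : ∀ {g h x} → g ≈ h → FixesOrInverts g x → FixesOrInverts h x
  FixesOrInverts-cong g≈h (inj₁ fix) = inj₁ (trans (conj-cong (sym g≈h) refl) fix)
  FixesOrInverts-cong g≈h (inj₂ inv) = inj₂ (trans (conj-cong (sym g≈h) refl) inv)

  FixesOrInverts-∙ : ∀ {g h x} → FixesOrInverts g x → FixesOrInverts h x → FixesOrInverts (g ∙ h) x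
  FixesOrInverts-∙         (inj₁ gfix) (inj₁ hfix) = inj₁ (trans (conj-∙-≈ hfix) gfix)
  FixesOrInverts-∙         (inj₂ ginv) (inj₁ hfix) = inj₂ (trans (conj-∙-≈ hfix) ginv)
  FixesOrInverts-∙ {g} {x = x} (inj₁ gfix) (inj₂ hinv) =
    inj₂ (trans (conj-∙-≈ hinv) (trans (conj-homo-⁻¹ g x) (⁻¹-cong gfix)))
  FixesOrInverts-∙ {g} {x = x} (inj₂ ginv) (inj₂ hinv) =
    inj₁ (trans (conj-∙-≈ hinv) (trans (conj-homo-⁻¹ g x) (trans (⁻¹-cong ginv) (⁻¹-involutive x))))

  FixesOrInverts-⁻¹ : ∀ {g x} → FixesOrInverts g x → FixesOrInverts (g ⁻¹) x
  FixesOrInverts-⁻¹ {g} {x} (inj₁ fix) = inj₁ (begin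
    conj (g ⁻¹) x           ≈⟨ conj-cong refl fix ⟨
    conj (g ⁻¹) (conj g x)  ≈⟨ conj-⁻¹-conj g x ⟩
    x                       ∎)
  FixesOrInverts-⁻¹ {g} {x} (inj₂ inv) = inj₂ (begin
    conj (g ⁻¹) x                 ≈⟨ conj-cong refl (⁻¹-involutive x) ⟨
    conj (g ⁻¹) (x ⁻¹ ⁻¹)         ≈⟨ conj-cong refl (⁻¹-cong inv) ⟨
    conj (g ⁻¹) (conj g x ⁻¹)     ≈⟨ conj-cong refl (conj-homo-⁻¹ g x) ⟨
    conj (g ⁻¹) (conj g (x ⁻¹))   ≈⟨ conj-⁻¹-conj g (x ⁻¹) ⟩
    x ⁻¹                          ∎)

  FixesOrInverts⇒normalizes : ∀ {g x} → FixesOrInverts g x → ∀ m → ∃ λ k → conj g (x ^ℤ m) ≈ x ^ℤ k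
  FixesOrInverts⇒normalizes {g} {x} (inj₁ fix) m = m , trans (conj-homo-^ℤ g x m) (^ℤ-congˡ m fix)
  FixesOrInverts⇒normalizes {g} {x} (inj₂ inv) m = - m , trans (ConjInverts-^ℤ m inv) (sym (^ℤ-homo-neg x m))

  module _ {a b d x : Carrier} (generators : ∀ k → FixesOrInverts (gen a b d k) x) where

    FixesOrInverts-evalWord : ∀ w → FixesOrInverts (evalWord a b d w) x
    FixesOrInverts-evalWord []               = inj₁ (conj-ε-left x)
    FixesOrInverts-evalWord ((k , false) ∷ w) = FixesOrInverts-∙ (generators k) (FixesOrInverts-evalWord w)
    FixesOrInverts-evalWord ((k , true) ∷ w)  =
      FixesOrInverts-∙ (FixesOrInverts-⁻¹ (generators k)) (FixesOrInverts-evalWord w)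

    generators-FixOrInvert⇒CyclicNormal : GeneratedBy a b d → CyclicNormal x
    generators-FixOrInvert⇒CyclicNormal generated g with generated g
    ... | w , g≈w = FixesOrInverts⇒normalizes (FixesOrInverts-cong (sym g≈w) (FixesOrInverts-evalWord w))

module Sggi3 {c ℓ : Level} (G : Group c ℓ) where
  open Group G hiding (_-_)
  open GroupDefs G
  open PowerProperties G
  open Conjugation G
  open CyclicNormality G
  open import Algebra.Properties.Group G
  open import Algebra.Properties.Monoid monoid using (cancelˡ; cancelʳ; cancelᶜ)
  open import Algebra.Solver.Monoid monoid using (solve; _⊜_; _⊕_)
  open import Relation.Binary.Reasoning.Setoid setoid

  module Generators {ρ₀ ρ₁ ρ₂ : Carrier}
           (ρ₀² : ρ₀ ∙ ρ₀ ≈ ε) (ρ₁² : ρ₁ ∙ ρ₁ ≈ ε) (ρ₂² : ρ₂ ∙ ρ₂ ≈ ε)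
           (ρ₀ρ₂² : ρ₀ ∙ ρ₂ ∙ (ρ₀ ∙ ρ₂) ≈ ε) where

    σ₁ σ₂ : Carrier
    σ₁ = ρ₀ ∙ ρ₁
    σ₂ = ρ₁ ∙ ρ₂

    ρ₁-inverts-σ₁ : ConjInverts ρ₁ σ₁
    ρ₁-inverts-σ₁ = involutions⇒ConjInverts-∙ʳ ρ₀² ρ₁²

    ρ₁-inverts-σ₂ : ConjInverts ρ₁ σ₂
    ρ₁-inverts-σ₂ = involutions⇒ConjInverts-∙ˡ ρ₁² ρ₂²

    σ₂-flips-σ₁ : Flips σ₂ σ₁
    σ₂-flips-σ₁ = involution⇒Flipsʳ (trans (∙-cong σ₁σ₂≈ρ₀ρ₂ σ₁σ₂≈ρ₀ρ₂) ρ₀ρ₂²)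
      where σ₁σ₂≈ρ₀ρ₂ : σ₁ ∙ σ₂ ≈ ρ₀ ∙ ρ₂
            σ₁σ₂≈ρ₀ρ₂ = cancelᶜ ρ₁² ρ₀ ρ₂

    generators-FixOrInvert : ∀ {x} → FixesOrInverts σ₁ x → FixesOrInverts ρ₁ x → FixesOrInverts σ₂ x →
                             ∀ k → FixesOrInverts (gen ρ₀ ρ₁ ρ₂ k) x
    generators-FixOrInvert σ₁x ρ₁x σ₂x zero             =
      FixesOrInverts-cong (cancelʳ ρ₁² ρ₀) (FixesOrInverts-∙ σ₁x ρ₁x)
    generators-FixOrInvert σ₁x ρ₁x σ₂x (suc zero)       = ρ₁x
    generators-FixOrInvert σ₁x ρ₁x σ₂x (suc (suc zero)) =
      FixesOrInverts-cong (cancelˡ ρ₁² ρ₂) (FixesOrInverts-∙ ρ₁x σ₂x)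

    module Relations (i j a b : ℤ)
             (H₁ : σ₂ ⁻¹ ∙ σ₁ ≈ σ₁ ^ℤ i ∙ ρ₁ ∙ σ₂ ^ℤ j)
             (H₂ : (σ₂ ^ℤ (+ 2)) ⁻¹ ∙ σ₁ ≈ σ₁ ^ℤ a ∙ σ₂ ^ℤ b) where

      p q : Carrier
      p = (σ₂ ^ℤ j) ⁻¹ ∙ σ₂ ⁻¹
      q = (σ₂ ^ℤ j) ⁻¹ ∙ (σ₂ ^ℤ (+ 2)) ⁻¹

      σ₁^i∙ρ₁≈ : σ₁ ^ℤ i ∙ ρ₁ ≈ σ₂ ⁻¹ ∙ σ₁ ∙ (σ₂ ^ℤ j) ⁻¹
      σ₁^i∙ρ₁≈ = sym (≈∙⇒∙⁻¹≈ H₁)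

      σ₁∙p-involution : σ₁ ∙ p ∙ (σ₁ ∙ p) ≈ ε
      σ₁∙p-involution = begin
        σ₁ ∙ p ∙ (σ₁ ∙ p)    ≈⟨ ∙-cong conj-σ₂ conj-σ₂ ⟨
        conj σ₂ v ∙ conj σ₂ v  ≈⟨ conj-involution σ₂ v-involution ⟩
        ε                      ∎
        where
        v : Carrier
        v = σ₂ ⁻¹ ∙ σ₁ ∙ (σ₂ ^ℤ j) ⁻¹
        v-involution : v ∙ v ≈ ε
        v-involution = trans (∙-cong (sym σ₁^i∙ρ₁≈) (sym σ₁^i∙ρ₁≈))
                             (ConjInverts⇒∙-involution ρ₁² (ConjInverts-^ℤ i ρ₁-inverts-σ₁))
        conj-σ₂ : conj σ₂ v ≈ σ₁ ∙ p
        conj-σ₂ = begin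
          σ₂ ∙ (σ₂ ⁻¹ ∙ σ₁ ∙ (σ₂ ^ℤ j) ⁻¹) ∙ σ₂ ⁻¹    ≈⟨ ∙-congʳ (∙-congˡ (assoc (σ₂ ⁻¹) σ₁ _)) ⟩
          σ₂ ∙ (σ₂ ⁻¹ ∙ (σ₁ ∙ (σ₂ ^ℤ j) ⁻¹)) ∙ σ₂ ⁻¹  ≈⟨ ∙-congʳ (cancelˡ (inverseʳ σ₂) _) ⟩
          σ₁ ∙ (σ₂ ^ℤ j) ⁻¹ ∙ σ₂ ⁻¹                   ≈⟨ assoc σ₁ _ _ ⟩
          σ₁ ∙ p                                      ∎

      q∙σ₁∙q≈σ₁ : q ∙ σ₁ ∙ q ≈ σ₁
      q∙σ₁∙q≈σ₁ = begin
        q ∙ σ₁ ∙ q                           ≈⟨ ∙-cong (∙-congʳ q≈σ₂⁻¹∙p) q≈p∙σ₂⁻¹ ⟩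
        σ₂ ⁻¹ ∙ p ∙ σ₁ ∙ (p ∙ σ₂ ⁻¹)         ≈⟨ Flips-cancel (involution⇒Flipsʳ σ₁∙p-involution) σ₂-flips-σ₁ ⟩
        σ₁                                   ∎
        where
        q≈p∙σ₂⁻¹ : q ≈ p ∙ σ₂ ⁻¹
        q≈p∙σ₂⁻¹ = begin
          (σ₂ ^ℤ j) ⁻¹ ∙ (σ₂ ∙ (σ₂ ∙ ε)) ⁻¹      ≈⟨ ∙-congˡ (⁻¹-cong (∙-congˡ (identityʳ σ₂))) ⟩
          (σ₂ ^ℤ j) ⁻¹ ∙ (σ₂ ∙ σ₂) ⁻¹            ≈⟨ ∙-congˡ (⁻¹-anti-homo-∙ σ₂ σ₂) ⟩
          (σ₂ ^ℤ j) ⁻¹ ∙ (σ₂ ⁻¹ ∙ σ₂ ⁻¹)         ≈⟨ assoc _ _ _ ⟨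
          p ∙ σ₂ ⁻¹                              ∎
        q≈σ₂⁻¹∙p : q ≈ σ₂ ⁻¹ ∙ p
        q≈σ₂⁻¹∙p = begin
          q                                      ≈⟨ q≈p∙σ₂⁻¹ ⟩
          (σ₂ ^ℤ j) ⁻¹ ∙ σ₂ ⁻¹ ∙ σ₂ ⁻¹           ≈⟨ ∙-congʳ (Commute-⁻¹ (sym (x∙x^ℤk≈x^ℤk∙x σ₂ j))) ⟩
          σ₂ ⁻¹ ∙ (σ₂ ^ℤ j) ⁻¹ ∙ σ₂ ⁻¹           ≈⟨ assoc _ _ _ ⟩
          σ₂ ⁻¹ ∙ p                              ∎

      σ₂⁻¹σ₁²-relation : σ₂ ⁻¹ ∙ σ₁ ^ℤ (+ 2) ≈ σ₁ ^ℤ (i - a) ∙ ρ₁ ∙ σ₂ ^ℤ ((b - j) - + 2)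
      σ₂⁻¹σ₁²-relation = sym (begin
        σ₁ ^ℤ (i - a) ∙ ρ₁ ∙ σ₂ ^ℤ ((b - j) - + 2)  ≈⟨ ∙-cong (∙-congʳ (^ℤ-homo-- σ₁ i a)) T^[b-j-2]≈ ⟩
        I ∙ A ⁻¹ ∙ ρ₁ ∙ (B ∙ J ⁻¹ ∙ T ⁻¹)           ≈⟨ reassoc₁ ⟩
        I ∙ (A ⁻¹ ∙ ρ₁) ∙ (B ∙ q)                   ≈⟨ ∙-congʳ (∙-congˡ (ConjInverts⇒⁻¹∙≈∙ (ConjInverts-^ℤ a ρ₁-inverts-σ₁))) ⟩
        I ∙ (ρ₁ ∙ A) ∙ (B ∙ q)                      ≈⟨ reassoc₂ ⟩
        I ∙ ρ₁ ∙ (A ∙ B) ∙ q                        ≈⟨ ∙-congʳ (∙-cong (sym σ₁^i∙ρ₁≈) H₂) ⟨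
        σ₂ ⁻¹ ∙ σ₁ ∙ J ⁻¹ ∙ (T ⁻¹ ∙ σ₁) ∙ q         ≈⟨ reassoc₃ ⟩
        σ₂ ⁻¹ ∙ σ₁ ∙ (q ∙ σ₁ ∙ q)                   ≈⟨ ∙-congˡ q∙σ₁∙q≈σ₁ ⟩
        σ₂ ⁻¹ ∙ σ₁ ∙ σ₁                             ≈⟨ trans (assoc _ _ _) (∙-congˡ (∙-congˡ (sym (identityʳ σ₁)))) ⟩
        σ₂ ⁻¹ ∙ σ₁ ^ℤ (+ 2)                         ∎)
        where
        I A B J T : Carrier
        I = σ₁ ^ℤ i
        A = σ₁ ^ℤ a
        B = σ₂ ^ℤ b
        J = σ₂ ^ℤ j
        T = σ₂ ^ℤ (+ 2)
        T^[b-j-2]≈ : σ₂ ^ℤ ((b - j) - + 2) ≈ B ∙ J ⁻¹ ∙ T ⁻¹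
        T^[b-j-2]≈ = trans (^ℤ-homo-- σ₂ (b - j) (+ 2)) (∙-congʳ (^ℤ-homo-- σ₂ b j))
        reassoc₁ : I ∙ A ⁻¹ ∙ ρ₁ ∙ (B ∙ J ⁻¹ ∙ T ⁻¹) ≈ I ∙ (A ⁻¹ ∙ ρ₁) ∙ (B ∙ q)
        reassoc₁ = solve 6 (λ I A′ ρ₁ B J′ T′ → ((I ⊕ A′) ⊕ ρ₁) ⊕ ((B ⊕ J′) ⊕ T′) ⊜ (I ⊕ (A′ ⊕ ρ₁)) ⊕ (B ⊕ (J′ ⊕ T′)))
                     refl I (A ⁻¹) ρ₁ B (J ⁻¹) (T ⁻¹)
        reassoc₂ : I ∙ (ρ₁ ∙ A) ∙ (B ∙ q) ≈ I ∙ ρ₁ ∙ (A ∙ B) ∙ q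
        reassoc₂ = solve 5 (λ I ρ₁ A B q → (I ⊕ (ρ₁ ⊕ A)) ⊕ (B ⊕ q) ⊜ ((I ⊕ ρ₁) ⊕ (A ⊕ B)) ⊕ q) refl I ρ₁ A B q
        reassoc₃ : σ₂ ⁻¹ ∙ σ₁ ∙ J ⁻¹ ∙ (T ⁻¹ ∙ σ₁) ∙ q ≈ σ₂ ⁻¹ ∙ σ₁ ∙ (q ∙ σ₁ ∙ q)
        reassoc₃ = solve 5 (λ σ₂′ σ₁ J′ T′ q → (((σ₂′ ⊕ σ₁) ⊕ J′) ⊕ (T′ ⊕ σ₁)) ⊕ q ⊜ (σ₂′ ⊕ σ₁) ⊕ (((J′ ⊕ T′) ⊕ σ₁) ⊕ q))
                     refl (σ₂ ⁻¹) σ₁ (J ⁻¹) (T ⁻¹) q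

      σ₂-inverts-σ₁^[i-3-a] : ConjInverts σ₂ (σ₁ ^ℤ ((i - + 3) - a))
      σ₂-inverts-σ₁^[i-3-a] =
        ConjInverts-cong x∙σ₁⁻¹≈ (Flips⇒ConjInverts-∙⁻¹ σ₂-flips-x σ₂-flips-σ₁ (sym (x∙x^ℤk≈x^ℤk∙x σ₁ k)))
        where
        k : ℤ
        k = (i - a) - + 2
        Z M S W : Carrier
        Z = σ₁ ^ℤ (i - a)
        M = σ₂ ^ℤ ((b - j) - + 2)
        S = σ₁ ^ℤ (+ 2)
        W = M ⁻¹ ∙ ρ₁
        W-involution : W ∙ W ≈ ε
        W-involution = ConjInverts⇒∙-involution ρ₁² (ConjInverts-⁻¹ (ConjInverts-^ℤ ((b - j) - + 2) ρ₁-inverts-σ₂))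
        Z≈ : Z ≈ σ₂ ⁻¹ ∙ S ∙ W
        Z≈ = begin
          Z                         ≈⟨ cancelʳ ρ₁² Z ⟨
          Z ∙ ρ₁ ∙ ρ₁               ≈⟨ cancelᶜ (inverseʳ M) (Z ∙ ρ₁) ρ₁ ⟨
          Z ∙ ρ₁ ∙ M ∙ (M ⁻¹ ∙ ρ₁)  ≈⟨ ∙-congʳ σ₂⁻¹σ₁²-relation ⟨
          σ₂ ⁻¹ ∙ S ∙ W             ∎
        σ₂∙x≈ : σ₂ ∙ σ₁ ^ℤ k ≈ conj S W
        σ₂∙x≈ = begin
          σ₂ ∙ σ₁ ^ℤ k                   ≈⟨ ∙-congˡ (^ℤ-homo-- σ₁ (i - a) (+ 2)) ⟩
          σ₂ ∙ (Z ∙ S ⁻¹)                ≈⟨ ∙-congˡ (∙-congʳ Z≈) ⟩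
          σ₂ ∙ (σ₂ ⁻¹ ∙ S ∙ W ∙ S ⁻¹)    ≈⟨ ∙-congˡ (trans (assoc _ _ _) (assoc _ _ _)) ⟩
          σ₂ ∙ (σ₂ ⁻¹ ∙ (S ∙ (W ∙ S ⁻¹))) ≈⟨ cancelˡ (inverseʳ σ₂) _ ⟩
          S ∙ (W ∙ S ⁻¹)                 ≈⟨ assoc S W (S ⁻¹) ⟨
          conj S W                       ∎
        σ₂-flips-x : Flips σ₂ (σ₁ ^ℤ k)
        σ₂-flips-x = involution⇒Flipsˡ (trans (∙-cong σ₂∙x≈ σ₂∙x≈) (conj-involution S W-involution))
        exponent : ∀ i a → ((i - a) - + 2) - + 1 ≡ (i - + 3) - a
        exponent = solve-∀
        x∙σ₁⁻¹≈ : σ₁ ^ℤ k ∙ σ₁ ⁻¹ ≈ σ₁ ^ℤ ((i - + 3) - a)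
        x∙σ₁⁻¹≈ = begin
          σ₁ ^ℤ k ∙ σ₁ ⁻¹             ≈⟨ ∙-congˡ (⁻¹-cong (identityʳ σ₁)) ⟨
          σ₁ ^ℤ k ∙ (σ₁ ^ℤ (+ 1)) ⁻¹  ≈⟨ ^ℤ-homo-- σ₁ k (+ 1) ⟨
          σ₁ ^ℤ (k - + 1)             ≈⟨ ^ℤ-congʳ σ₁ (exponent i a) ⟩
          σ₁ ^ℤ ((i - + 3) - a)       ∎

      σ₁-commutes-σ₂^[b-2] : Commute σ₁ (σ₂ ^ℤ (b - + 2))
      σ₁-commutes-σ₂^[b-2] =
        Commute-congʳ (sym (trans (^ℤ-homo-- σ₂ b (+ 2)) B∙T⁻¹≈T⁻¹∙B))
                      (relation-and-reverse⇒Commute H₂ H₂-reversed B∙T⁻¹≈T⁻¹∙B)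
        where
        H₂-reversed : σ₁ ∙ (σ₂ ^ℤ (+ 2)) ⁻¹ ≈ σ₂ ^ℤ b ∙ σ₁ ^ℤ a
        H₂-reversed = ConjInverts-reverse (ConjInverts-⁻¹ (ConjInverts-^ℤ (+ 2) ρ₁-inverts-σ₂)) ρ₁-inverts-σ₁
                        (ConjInverts-^ℤ a ρ₁-inverts-σ₁) (ConjInverts-^ℤ b ρ₁-inverts-σ₂) H₂
        B∙T⁻¹≈T⁻¹∙B : σ₂ ^ℤ b ∙ (σ₂ ^ℤ (+ 2)) ⁻¹ ≈ (σ₂ ^ℤ (+ 2)) ⁻¹ ∙ σ₂ ^ℤ b
        B∙T⁻¹≈T⁻¹∙B = sym (Commute-⁻¹ˡ (^ℤ-commute σ₂ (+ 2) b))

      σ₁^[i-3-a]-cyclicNormal : GeneratedBy ρ₀ ρ₁ ρ₂ → CyclicNormal (σ₁ ^ℤ ((i - + 3) - a))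
      σ₁^[i-3-a]-cyclicNormal = generators-FixOrInvert⇒CyclicNormal (generators-FixOrInvert
        (inj₁ (Commute⇒conj≈ (x∙x^ℤk≈x^ℤk∙x σ₁ ((i - + 3) - a))))
        (inj₂ (ConjInverts-^ℤ ((i - + 3) - a) ρ₁-inverts-σ₁))
        (inj₂ σ₂-inverts-σ₁^[i-3-a]))

      σ₂^[b-2]-cyclicNormal : GeneratedBy ρ₀ ρ₁ ρ₂ → CyclicNormal (σ₂ ^ℤ (b - + 2))
      σ₂^[b-2]-cyclicNormal = generators-FixOrInvert⇒CyclicNormal (generators-FixOrInvert
        (inj₁ (Commute⇒conj≈ σ₁-commutes-σ₂^[b-2]))
        (inj₂ (ConjInverts-^ℤ (b - + 2) ρ₁-inverts-σ₂))
        (inj₁ (Commute⇒conj≈ (x∙x^ℤk≈x^ℤk∙x σ₂ (b - + 2)))))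

lemma3p5 : ∀ {c ℓ : Level} (G : Group c ℓ) →
    let open Group G hiding (_-_)
        open GroupDefs G
    in
    ∀ (ρ₀ ρ₁ ρ₂ : Carrier) → IsSggi3 ρ₀ ρ₁ ρ₂ →
    let σ₁ = ρ₀ ∙ ρ₁
        σ₂ = ρ₁ ∙ ρ₂
    in
    ∀ (i j a b : ℤ) →
    (σ₂ ⁻¹) ∙ σ₁ ≈ ((σ₁ ^ℤ i) ∙ ρ₁) ∙ (σ₂ ^ℤ j) →
    ((σ₂ ^ℤ (+ 2)) ⁻¹) ∙ σ₁ ≈ (σ₁ ^ℤ a) ∙ (σ₂ ^ℤ b) →
    ((σ₂ ⁻¹) ∙ (σ₁ ^ℤ (+ 2)) ≈ ((σ₁ ^ℤ (i - a)) ∙ ρ₁) ∙ (σ₂ ^ℤ ((b - j) - + 2)))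
    × ConjInverts σ₂ (σ₁ ^ℤ ((i - + 3) - a))
    × Commute σ₁ (σ₂ ^ℤ (b - + 2))
    × CyclicNormal (σ₁ ^ℤ ((i - + 3) - a))
    × CyclicNormal (σ₂ ^ℤ (b - + 2))
lemma3p5 G ρ₀ ρ₁ ρ₂ (generated , (ρ₀² , _) , (ρ₁² , _) , (ρ₂² , _) , ρ₀ρ₂²) i j a b H₁ H₂ =
    σ₂⁻¹σ₁²-relation
  , σ₂-inverts-σ₁^[i-3-a]
  , σ₁-commutes-σ₂^[b-2]
  , σ₁^[i-3-a]-cyclicNormal generated
  , σ₂^[b-2]-cyclicNormal generated
  where open Sggi3.Generators G ρ₀² ρ₁² ρ₂² ρ₀ρ₂²
        open Relations i j a b H₁ H₂
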